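{- Let $p\in\mathrm{OFS}(\mathbb{Z}^+)$ with $\min(p)=\gcd(p)$. Then $fw(p)=\min(p)$ and $f(p)=\max(p)$.
   Context: $\mathrm{OFS}(\mathbb{Z}^+)$ denotes the set of all nonempty strictly increasing finite sequences of positive integers. For $p\in\mathrm{OFS}(\mathbb{Z}^+)$, $|p|$ is its length, $p_i$ its $i$-th entry, $p|_i=(p_1,\ldots,p_i)$, $\gcd(p)$ the gcd of its entries, $\min(p)=p_1$, $\max(p)=p_{|p|}$. The map $R$: $R(p)=p$ if $|p|=1$; if $n=|p|>1$, form $(p_2-p_1,\ldots,p_n-p_1)$ and, if $p_1$ does not appear in it, insert $p_1$ so that the result is strictly increasing. $f$ is defined recursively by $f(p)=p_1$ if $|p|=1$ and $f(p)=p_1+f(R(p))$ if $|p|>1$. $fw$ is defined by: if $n=|p|>1$, $\gcd(p|_{n-1})=\gcd(p)$ and $\max(p)\ge f(p|_{n-1})$, then $fw(p)=fw(p|_{n-1})$; otherwise $fw(p)=f(p)$. -}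

module Defs where

open import Data.Nat using (ℕ; zero; suc; _+_; _∸_; _<_; _≤_; _<?_; _≤?_; _≟_)
open import Data.Nat.GCD using (gcd)
open import Data.List using (List; []; _∷_; map; foldr; length)
open import Data.List.Relation.Unary.All using (All)
open import Data.List.Relation.Unary.Linked using (Linked)
open import Data.Bool using (Bool; true; false; if_then_else_; _∧_)
open import Relation.Nullary.Decidable using (⌊_⌋)

record OFS (p : List ℕ) : Set where
  field
    nonempty   : 0 < length p
    increasing : Linked _<_ p
    positive   : All (0 <_) p

-- min(p) = p₁ (first entry); default 0 on the empty list (never used for OFS).
minL : List ℕ → ℕ
minL []      = 0
minL (a ∷ _) = a

maxL : List ℕ → ℕ
maxL []           = 0
maxL (a ∷ [])     = a
maxL (_ ∷ b ∷ xs) = maxL (b ∷ xs)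

gcdL : List ℕ → ℕ
gcdL = foldr gcd 0

dropLast : List ℕ → List ℕ
dropLast []           = []
dropLast (_ ∷ [])     = []
dropLast (a ∷ b ∷ xs) = a ∷ dropLast (b ∷ xs)

insertStrict : ℕ → List ℕ → List ℕ
insertStrict a []       = a ∷ []
insertStrict a (y ∷ ys) =
  if ⌊ a <? y ⌋ then a ∷ y ∷ ys
  else if ⌊ a ≟ y ⌋ then y ∷ ys
  else y ∷ insertStrict a ys

R : List ℕ → List ℕ
R []           = []
R (a ∷ [])     = a ∷ []
R (a ∷ b ∷ xs) = insertStrict a (map (_∸ a) (b ∷ xs))

-- f, computed with fuel (R strictly decreases max on OFS of length > 1,
-- so fuel suc (max p) is always sufficient).
fFuel : ℕ → List ℕ → ℕ
fFuel zero    _            = 0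
fFuel (suc k) []           = 0
fFuel (suc k) (a ∷ [])     = a
fFuel (suc k) (a ∷ b ∷ xs) = a + fFuel k (R (a ∷ b ∷ xs))

f : List ℕ → ℕ
f p = fFuel (suc (maxL p)) p

-- fw, computed with fuel (recursion is on p|_{n-1}, so fuel length p suffices).
fwFuel : ℕ → List ℕ → ℕ
fwFuel zero    p = f p
fwFuel (suc k) [] = f []
fwFuel (suc k) (a ∷ []) = f (a ∷ [])
fwFuel (suc k) (a ∷ b ∷ xs) =
  let p = a ∷ b ∷ xs ; q = dropLast p in
  if ⌊ gcdL q ≟ gcdL p ⌋ ∧ ⌊ f q ≤? maxL p ⌋ then fwFuel k q else f p

fw : List ℕ → ℕ
fw p = fwFuel (length p) p

module Submission where

-- Every entry after the first is then a multiple of a that exceeds a; we call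
-- such a tail a "chain of multiples of a above a" (MultipleChain a a).  The
-- whole argument rests on one invariant of the map R:
--   R (a ∷ rest) = a ∷ rest'  with  rest'  again a chain of multiples of a
--   above a, and  max (a ∷ rest') = max rest ∸ a,
-- since subtracting a keeps multiples of a and the head a is re-inserted in
-- front (or coincides with the new least entry).  Unfolding f, each step
-- adds a and lowers the maximum by a, so f p = max p.  For fw, truncating the
-- last entry preserves the chain property; hence the gcd is still a and, by
-- the first part, f of the truncation is its maximum, which is ≤ max p.  So
-- fw always recurses on the truncation until only a remains: fw p = a.

open import Defs
open import Data.Nat using (ℕ; suc; _+_; _∸_; _<_; _≤_; _<?_; _≤?_; _≟_; s≤s; >-nonZero)
open import Data.Nat.Properties
open import Data.Nat.Divisibility
open import Data.Nat.GCD using (gcd[m,n]∣m; gcd[m,n]∣n; gcd-greatest)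
open import Data.List using (List; []; _∷_; map; length)
open import Data.List.Relation.Unary.All as All using (All; []; _∷_)
open import Data.List.Relation.Unary.Linked using (Linked; [-]; _∷_)
open import Data.Product using (_×_; _,_; Σ-syntax)
open import Relation.Binary.PropositionalEquality
open import Relation.Nullary using (yes; no)
open import Relation.Nullary.Negation using (contradiction)

data MultipleChain (a : ℕ) : ℕ → List ℕ → Set where
  []  : ∀ {lo} → MultipleChain a lo []
  _∷_ : ∀ {lo x xs} → lo < x × a ∣ x → MultipleChain a x xs →
        MultipleChain a lo (x ∷ xs)

bound<max : ∀ {a lo x xs} → MultipleChain a lo (x ∷ xs) → lo < maxL (x ∷ xs)
bound<max ((lo<x , _) ∷ [])        = lo<x
bound<max ((lo<x , _) ∷ c@(_ ∷ _)) = <-trans lo<x (bound<max c)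

-- The maximum is the last entry, so it commutes with every map.
maxL-map : ∀ (g : ℕ → ℕ) x xs → maxL (map g (x ∷ xs)) ≡ g (maxL (x ∷ xs))
maxL-map g x []       = refl
maxL-map g x (y ∷ ys) = maxL-map g y ys

∣-∸-self : ∀ {a x} → a ≤ x → a ∣ x → a ∣ x ∸ a
∣-∸-self {a} a≤x a∣x = ∣m+n∣m⇒∣n (subst (a ∣_) (sym (m+[n∸m]≡n a≤x)) a∣x) ∣-refl

∸-self-multiple : ∀ {a b} → a < b → a ∣ b → a ≤ b ∸ a × a ∣ b ∸ a
∸-self-multiple {a} {b} a<b a∣b =
  ∣⇒≤ {{>-nonZero (m<n⇒0<n∸m a<b)}} a∣b∸a , a∣b∸a
  where
  a∣b∸a : a ∣ b ∸ a
  a∣b∸a = ∣-∸-self (<⇒≤ a<b) a∣b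

shift-chain : ∀ {a lo xs} → a ≤ lo → MultipleChain a lo xs →
              MultipleChain a (lo ∸ a) (map (_∸ a) xs)
shift-chain a≤lo []   = []
shift-chain {a} {xs = x ∷ _} a≤lo ((lo<x , a∣x) ∷ c) =
  (∸-monoˡ-< lo<x a≤lo , ∣-∸-self a≤x a∣x) ∷ shift-chain a≤x c
  where
  a≤x : a ≤ x
  a≤x = ≤-trans a≤lo (<⇒≤ lo<x)

insertStrict-head : ∀ {a y ys} → a ≤ y → a ∣ y → MultipleChain a y ys →
  Σ[ r ∈ List ℕ ] insertStrict a (y ∷ ys) ≡ a ∷ r × MultipleChain a a r
                  × maxL (a ∷ r) ≡ maxL (y ∷ ys)
insertStrict-head {a} {y} {ys} a≤y a∣y c with a <? y
... | yes a<y = y ∷ ys , refl , (a<y , a∣y) ∷ c , refl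
... | no a≮y with a ≟ y
...   | yes refl = ys , refl , c , refl
...   | no a≢y   = contradiction (≤∧≢⇒< a≤y a≢y) a≮y

R-chain : ∀ {a b xs} → MultipleChain a a (b ∷ xs) →
  Σ[ r ∈ List ℕ ] R (a ∷ b ∷ xs) ≡ a ∷ r × MultipleChain a a r
                  × maxL (a ∷ r) ≡ maxL (b ∷ xs) ∸ a
R-chain {a} {b} {xs} ((a<b , a∣b) ∷ c)
  with a≤b∸a , a∣b∸a ← ∸-self-multiple a<b a∣b
  with r , eq , c′ , max-eq ← insertStrict-head a≤b∸a a∣b∸a (shift-chain (<⇒≤ a<b) c)
  = r , eq , c′ , trans max-eq (maxL-map (_∸ a) b xs)

-- With enough fuel, f of a ∷ chain is its maximum: each R-step contributes a
-- and lowers the maximum by exactly a.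
fFuel-chain : ∀ n {a rest} → 0 < a → MultipleChain a a rest →
              maxL (a ∷ rest) < n → fFuel n (a ∷ rest) ≡ maxL (a ∷ rest)
fFuel-chain (suc n) {a} {[]}     0<a c       _        = refl
fFuel-chain (suc n) {a} {b ∷ xs} 0<a c (s≤s max≤n)
  with r , eq , c′ , max-eq ← R-chain c rewrite eq =
  begin
    a + fFuel n (a ∷ r)     ≡⟨ cong (a +_) (fFuel-chain n 0<a c′ max′<n) ⟩
    a + maxL (a ∷ r)        ≡⟨ cong (a +_) max-eq ⟩
    a + (maxL (b ∷ xs) ∸ a) ≡⟨ m+[n∸m]≡n (<⇒≤ (bound<max c)) ⟩
    maxL (b ∷ xs)           ∎
  where
  open ≡-Reasoning
  max′<n : maxL (a ∷ r) < n
  max′<n = subst (_< n) (sym max-eq)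
                 (<-≤-trans (∸-monoʳ-< 0<a (<⇒≤ (bound<max c))) max≤n)

f-chain : ∀ {a rest} → 0 < a → MultipleChain a a rest → f (a ∷ rest) ≡ maxL (a ∷ rest)
f-chain 0<a c = fFuel-chain _ 0<a c ≤-refl

∣-gcd-chain : ∀ {a lo xs} → MultipleChain a lo xs → a ∣ gcdL xs
∣-gcd-chain []              = _ ∣0
∣-gcd-chain ((_ , a∣x) ∷ c) = gcd-greatest a∣x (∣-gcd-chain c)

gcd-chain : ∀ {a rest} → MultipleChain a a rest → gcdL (a ∷ rest) ≡ a
gcd-chain {a} c = ∣-antisym (gcd[m,n]∣m a _) (gcd-greatest ∣-refl (∣-gcd-chain c))

dropLast-chain : ∀ {a lo xs} → MultipleChain a lo xs →
  MultipleChain a lo (dropLast xs) × maxL (lo ∷ dropLast xs) ≤ maxL (lo ∷ xs)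
dropLast-chain []                 = [] , ≤-refl
dropLast-chain ((lo<x , _) ∷ [])  = [] , <⇒≤ lo<x
dropLast-chain (x-ok ∷ c@(_ ∷ _)) with c′ , max≤ ← dropLast-chain c = x-ok ∷ c′ , max≤

length-dropLast : ∀ b xs → length (dropLast (b ∷ xs)) ≡ length xs
length-dropLast b []       = refl
length-dropLast b (c ∷ xs) = cong suc (length-dropLast c xs)

fwFuel-recurse : ∀ k a b xs → let p = a ∷ b ∷ xs ; q = dropLast p in
  gcdL q ≡ gcdL p → f q ≤ maxL p → fwFuel (suc k) p ≡ fwFuel k q
fwFuel-recurse k a b xs gcd-eq f≤max
  with gcdL (dropLast (a ∷ b ∷ xs)) ≟ gcdL (a ∷ b ∷ xs)
... | no gcd-neq = contradiction gcd-eq gcd-neq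
... | yes _ with f (dropLast (a ∷ b ∷ xs)) ≤? maxL (a ∷ b ∷ xs)
...   | no f≰max = contradiction f≤max f≰max
...   | yes _    = refl

fwFuel-chain : ∀ n {a rest} → length rest ≡ n → 0 < a → MultipleChain a a rest →
               fwFuel (suc n) (a ∷ rest) ≡ a
fwFuel-chain n       {rest = []}     _   _   _ = refl
fwFuel-chain (suc n) {a} {b ∷ xs} len 0<a c
  with c′ , max≤ ← dropLast-chain {lo = a} c =
  trans (fwFuel-recurse (suc n) a b xs (trans (gcd-chain c′) (sym (gcd-chain c)))
                                       (subst (_≤ maxL (b ∷ xs)) (sym (f-chain 0<a c′)) max≤))
        (fwFuel-chain n (trans (length-dropLast b xs) (suc-injective len)) 0<a c′)

gcdL-∣-all : ∀ xs → All (gcdL xs ∣_) xs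
gcdL-∣-all []       = []
gcdL-∣-all (x ∷ xs) =
  gcd[m,n]∣m x (gcdL xs) ∷ All.map (∣-trans (gcd[m,n]∣n x (gcdL xs))) (gcdL-∣-all xs)

increasing-chain : ∀ {a lo xs} → Linked _<_ (lo ∷ xs) → All (a ∣_) xs →
                   MultipleChain a lo xs
increasing-chain [-]           []           = []
increasing-chain (lo<x ∷ incr) (a∣x ∷ a∣xs) = (lo<x , a∣x) ∷ increasing-chain incr a∣xs

ofs-chain : ∀ {a rest} → OFS (a ∷ rest) → a ≡ gcdL (a ∷ rest) → MultipleChain a a rest
ofs-chain {a} {rest} ofs a≡gcd with _ ∷ gcd∣rest ← gcdL-∣-all (a ∷ rest) =
  increasing-chain (OFS.increasing ofs)
                   (subst (λ g → All (g ∣_) rest) (sym a≡gcd) gcd∣rest)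

proposition9 : (p : List ℕ) → OFS p → minL p ≡ gcdL p →
    (fw p ≡ minL p) × (f p ≡ maxL p)
proposition9 [] ofs _ with () ← OFS.nonempty ofs
proposition9 (a ∷ rest) ofs a≡gcd with 0<a ∷ _ ← OFS.positive ofs =
  fwFuel-chain (length rest) refl 0<a chain , f-chain 0<a chain
  where
  chain : MultipleChain a a rest
  chain = ofs-chain ofs a≡gcd
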